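{- Let $H$ be a graph and $P$ a path in $H$ such that every internal vertex of $P$ has degree $2$ in $H$ (the endpoints of $P$ may be adjacent). Let $G$ be a graph such that $H$ is an induced minor of $G$, and let $\mathcal{X}_H=\{X_w : w\in V(H)\}$ be an induced minor model of $H$ in $G$. Then there is an induced minor model $\mathcal{X}'_H=\{X'_w: w\in V(H)\}$ of $H$ in $G$ included in $\mathcal{X}_H$ such that every internal vertex of $P$ has a trivial bag in $\mathcal{X}'_H$. Moreover, only the bag of one of the endpoints of $P$ is bigger in $\mathcal{X}'_H$ than it was in $\mathcal{X}_H$, and $X'_w=X_w$ for every $w\in V(H)\setminus V(P)$.
   Context: All graphs are finite, simple and undirected. $H$ is an induced minor of $G$ if $H$ can be obtained from $G$ by deleting vertices and contracting edges. An induced minor model of $H$ in $G$ is a collection $\{X_w : w\in V(H)\}$ of pairwise disjoint non-empty subsets of $V(G)$ (bags) such that each $G[X_w]$ is connected, and for distinct $w,w'$, some vertex of $X_w$ is adjacent in $G$ to some vertex of $X_{w'}$ if and only if $ww'\in E(H)$. A bag is trivial if it has exactly one vertex. A model $\mathcal{X}'$ is included in a model $\mathcal{X}$ if the union of the bags of $\mathcal{X}'$ is contained in the union of the bags of $\mathcal{X}$ (individual bags need not be contained in one another). -}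

module Defs where

open import Data.Nat using (ℕ; suc; _<_; _≤_)
open import Data.Fin using (Fin; toℕ; inject₁; fromℕ; zero) renaming (suc to fsuc)
open import Data.Fin.Subset using (Subset; _∈_; ∣_∣)
open import Data.Vec using (tabulate)
open import Data.Product using (Σ; _×_; ∃; _,_)
open import Data.Sum using (_⊎_)
open import Data.Empty using (⊥)
open import Relation.Nullary using (¬_; Dec; does)
open import Relation.Binary.PropositionalEquality using (_≡_; _≢_)
open import Function.Bundles using (_⇔_)
open import Function.Definitions using (Injective)

record Graph : Set₁ where
  field
    n      : ℕ
    Adj    : Fin n → Fin n → Set
    sym    : ∀ {u v} → Adj u v → Adj v u
    irrefl : ∀ {u} → ¬ Adj u u
    dec    : ∀ u v → Dec (Adj u v)
open Graph public

V : Graph → Set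
V G = Fin (n G)

N : (G : Graph) → V G → Subset (n G)
N G v = tabulate (λ u → does (dec G v u))

degree : (G : Graph) → V G → ℕ
degree G v = ∣ N G v ∣

data Reach (G : Graph) (X : Subset (n G)) : V G → V G → Set where
  here  : ∀ {u} → u ∈ X → Reach G X u u
  step  : ∀ {u w v} → u ∈ X → Adj G u w → Reach G X w v → Reach G X u v

Connected : (G : Graph) → Subset (n G) → Set
Connected G X = (∃ λ x → x ∈ X) × (∀ {u v} → u ∈ X → v ∈ X → Reach G X u v)

Touch : (G : Graph) → Subset (n G) → Subset (n G) → Set
Touch G X Y = Σ (V G) λ x → Σ (V G) λ y → x ∈ X × y ∈ Y × Adj G x y

record InducedMinorModel (H G : Graph) : Set where
  field
    bag       : V H → Subset (n G)
    connected : ∀ w → Connected G (bag w)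
    disjoint  : ∀ {w w'} → w ≢ w' → ∀ {x} → x ∈ bag w → x ∈ bag w' → ⊥
    touch     : ∀ {w w'} → w ≢ w' → Touch G (bag w) (bag w') ⇔ Adj H w w'
open InducedMinorModel public

IsInducedMinor : Graph → Graph → Set
IsInducedMinor H G = InducedMinorModel H G

Included : ∀ {H G} → InducedMinorModel H G → InducedMinorModel H G → Set
Included {H} {G} X' X = ∀ (w : V H) {x : V G} → x ∈ bag X' w → Σ (V H) λ w' → x ∈ bag X w'

Trivial : ∀ {G} → Subset (n G) → Set
Trivial X = ∣ X ∣ ≡ 1

record Path (H : Graph) : Set where
  field
    len   : ℕ
    vtx   : Fin (suc len) → V H
    inj   : Injective _≡_ _≡_ vtx
    adj   : ∀ (i : Fin len) → Adj H (vtx (inject₁ i)) (vtx (fsuc i))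
open Path public

start : ∀ {H} → Path H → V H
start P = vtx P zero

end : ∀ {H} → Path H → V H
end P = vtx P (fromℕ (len P))

Internal : ∀ {H} → (P : Path H) → Fin (suc (len P)) → Set
Internal P i = 0 < toℕ i × toℕ i < len P

OnPath : ∀ {H} → Path H → V H → Set
OnPath P w = ∃ λ i → vtx P i ≡ w

module Submission where

-- Write p₀ … p_k for P. The bags of the internal vertices p₁ … p_{k-1} contain a walk starting next to
-- X(p₀) and ending next to X(p_k); a shortest one, q₀ … q_ℓ, is an induced path of which only q₀ has a
-- neighbour in X(p₀) and only q_ℓ one in X(p_k). As p_{b+1} has degree 2, its bag only sees the bags of
-- p_b and p_{b+2} and none off the path, so the walk moves by at most one bag per step and needs at least
-- k - 1 vertices. Giving p_{b+1} the bag {q_{ℓ-k+1+b}}, adding the earlier q_j to X(p₀) and keeping all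
-- other bags yields the required model.

open import Defs
open import Data.Nat using (ℕ; zero; suc; _+_; _∸_; _≤_; _<_; z≤n; s≤s; _≤?_; _<?_)
open import Data.Nat.Properties
open import Data.Nat.Induction using (<-wellFounded)
open import Induction.WellFounded using (Acc; acc)
open import Data.Fin using (Fin; toℕ; fromℕ<; inject₁) renaming (suc to fsuc; _≟_ to _≟ᶠ_)
import Data.Fin.Properties as Finₚ
open import Data.Fin.Subset using (Subset; _∈_; ∣_∣; ⁅_⁆; _∪_; _-_; ⋃)
open import Data.Fin.Subset.Properties
  using (_∈?_; ∣⁅x⁆∣≡1; ∉⊥; x∈⁅x⁆; x∈⁅y⁆⇒x≡y; x∈p∪q⁺; x∈p∪q⁻; x∈p∧x≢y⇒x∈p-y; x∈p⇒∣p-x∣<∣p∣)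
open import Data.List using (applyUpTo)
open import Data.Vec.Properties using (lookup∘tabulate; lookup⇒[]=)
open import Data.Product using (Σ; ∃; _×_; _,_; proj₁; proj₂)
open import Data.Sum using (_⊎_; inj₁; inj₂)
open import Data.Empty using (⊥; ⊥-elim)
open import Function using (_∘_; id)
open import Function.Bundles using (_⇔_; mk⇔; Equivalence)
open import Function.Properties.Equivalence using () renaming (trans to ⇔-trans)
open import Relation.Nullary using (¬_; Dec; yes; no; _×-dec_; contradiction)
open import Relation.Nullary.Decidable using (dec-true)
open import Relation.Binary.PropositionalEquality
  using (_≡_; _≢_; refl; trans; cong; subst; subst₂; module ≡-Reasoning) renaming (sym to ≡-sym)
open import Relation.Binary.Definitions using (tri<; tri≈; tri>)

∈⋃-applyUpTo⁺ : ∀ {m c j} {x : Fin m} (f : ℕ → Subset m) → j < c → x ∈ f j → x ∈ ⋃ (applyUpTo f c)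
∈⋃-applyUpTo⁺ {j = zero}  f (s≤s _)   x∈fj = x∈p∪q⁺ (inj₁ x∈fj)
∈⋃-applyUpTo⁺ {j = suc j} f (s≤s j<c) x∈fj = x∈p∪q⁺ (inj₂ (∈⋃-applyUpTo⁺ (f ∘ suc) j<c x∈fj))

∈⋃-applyUpTo⁻ : ∀ {m} {x : Fin m} (f : ℕ → Subset m) c → x ∈ ⋃ (applyUpTo f c) → ∃ λ j → j < c × x ∈ f j
∈⋃-applyUpTo⁻ f zero    x∈ = ⊥-elim (∉⊥ x∈)
∈⋃-applyUpTo⁻ f (suc c) x∈ with x∈p∪q⁻ (f 0) _ x∈
... | inj₁ x∈f0 = 0 , s≤s z≤n , x∈f0
... | inj₂ x∈fs with ∈⋃-applyUpTo⁻ (f ∘ suc) c x∈fs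
...   | j , j<c , x∈fj = suc j , s≤s j<c , x∈fj

x,y,z∈p⇒3≤∣p∣ : ∀ {m} {p : Subset m} {x y z} → x ∈ p → y ∈ p → z ∈ p →
                y ≢ x → z ≢ x → z ≢ y → 3 ≤ ∣ p ∣
x,y,z∈p⇒3≤∣p∣ {p = p} {x} {y} {z} x∈p y∈p z∈p y≢x z≢x z≢y =
  ≤-trans (s≤s (≤-trans (s≤s 1≤∣p-x-y∣) (x∈p⇒∣p-x∣<∣p∣ y∈p-x))) (x∈p⇒∣p-x∣<∣p∣ x∈p)
  where
  y∈p-x : y ∈ p - x
  y∈p-x = x∈p∧x≢y⇒x∈p-y y∈p y≢x
  1≤∣p-x-y∣ : 1 ≤ ∣ p - x - y ∣
  1≤∣p-x-y∣ = ≤-<-trans z≤n (x∈p⇒∣p-x∣<∣p∣ (x∈p∧x≢y⇒x∈p-y (x∈p∧x≢y⇒x∈p-y z∈p z≢x) z≢y))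

m+n≤m⇒n≡0 : ∀ m {n} → m + n ≤ m → n ≡ 0
m+n≤m⇒n≡0 m {zero}  _       = refl
m+n≤m⇒n≡0 m {suc n} m+n≤m = contradiction m+n≤m (m+1+n≰m m)

module _ (G : Graph) where

  Adj⇒∈N : ∀ {u v} → Adj G u v → v ∈ N G u
  Adj⇒∈N {u} {v} a = lookup⇒[]= v _ (trans (lookup∘tabulate _ v) (dec-true (dec G u v) a))

  HasNbrIn : Subset (n G) → V G → Set
  HasNbrIn S x = Σ (V G) λ y → y ∈ S × Adj G x y

  hasNbrIn? : ∀ S x → Dec (HasNbrIn S x)
  hasNbrIn? S x = Finₚ.any? λ y → (y ∈? S) ×-dec dec G x y

  Touch-sym : ∀ {X Y} → Touch G X Y → Touch G Y X
  Touch-sym (x , y , x∈X , y∈Y , a) = y , x , y∈Y , x∈X , sym G a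

  Reach-start : ∀ {X u v} → Reach G X u v → u ∈ X
  Reach-start (here u∈X)     = u∈X
  Reach-start (step u∈X _ _) = u∈X

  Reach-trans : ∀ {X u v w} → Reach G X u v → Reach G X v w → Reach G X u w
  Reach-trans (here _)       r′ = r′
  Reach-trans (step u∈X a r) r′ = step u∈X a (Reach-trans r r′)

  Reach-sym : ∀ {X u v} → Reach G X u v → Reach G X v u
  Reach-sym (here u∈X)     = here u∈X
  Reach-sym (step u∈X a r) = Reach-trans (Reach-sym r) (step (Reach-start r) (sym G a) (here u∈X))

  Reach-mono : ∀ {X Y u v} → (∀ {x} → x ∈ X → x ∈ Y) → Reach G X u v → Reach G Y u v
  Reach-mono X⊆Y (here u∈X)     = here (X⊆Y u∈X)
  Reach-mono X⊆Y (step u∈X a r) = step (X⊆Y u∈X) a (Reach-mono X⊆Y r)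

  ⁅⁆-Touch⇔ : ∀ {x Y} → Touch G ⁅ x ⁆ Y ⇔ HasNbrIn Y x
  ⁅⁆-Touch⇔ {x} = mk⇔ (λ (x′ , y , x′∈ , y∈ , x′~y) → y , y∈ , subst (λ z → Adj G z y) (x∈⁅y⁆⇒x≡y x x′∈) x′~y)
                      (λ (y , y∈ , x~y) → x , y , x∈⁅x⁆ x , y∈ , x~y)

  Touch-⁅⁆⇔ : ∀ {x Y} → Touch G Y ⁅ x ⁆ ⇔ HasNbrIn Y x
  Touch-⁅⁆⇔ = ⇔-trans (mk⇔ Touch-sym Touch-sym) ⁅⁆-Touch⇔

  ⁅⁆-Touch-⁅⁆⇔ : ∀ {x y} → Touch G ⁅ x ⁆ ⁅ y ⁆ ⇔ Adj G x y
  ⁅⁆-Touch-⁅⁆⇔ {x} {y} = ⇔-trans ⁅⁆-Touch⇔ (mk⇔ (λ (y′ , y′∈ , x~y′) → subst (Adj G x) (x∈⁅y⁆⇒x≡y y y′∈) x~y′)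
                                                 (λ x~y → y , x∈⁅x⁆ y , x~y))

  Touch⇔Adj-sym : ∀ (H : Graph) {Y Z v v′} → Touch G Y Z ⇔ Adj H v v′ → Touch G Z Y ⇔ Adj H v′ v
  Touch⇔Adj-sym H T⇔A = mk⇔ (sym H ∘ Equivalence.to T⇔A ∘ Touch-sym) (Touch-sym ∘ Equivalence.from T⇔A ∘ sym H)

  ⁅⁆-connected : ∀ x → Connected G ⁅ x ⁆
  ⁅⁆-connected x = (x , x∈⁅x⁆ x) , λ {u} {v} u∈ v∈ →
    subst₂ (Reach G ⁅ x ⁆) (≡-sym (x∈⁅y⁆⇒x≡y x u∈)) (≡-sym (x∈⁅y⁆⇒x≡y x v∈)) (here (x∈⁅x⁆ x))

  module _ {X : Subset (n G)} where

    reachLength : ∀ {u v} → Reach G X u v → ℕ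
    reachLength (here _)     = 0
    reachLength (step _ _ r) = suc (reachLength r)

    reachAt : ∀ {u v} → Reach G X u v → ℕ → V G
    reachAt {u} (here _)     _       = u
    reachAt {u} (step _ _ _) zero    = u
    reachAt     (step _ _ r) (suc t) = reachAt r t

    reachAt-zero : ∀ {u v} (r : Reach G X u v) → reachAt r 0 ≡ u
    reachAt-zero (here _)     = refl
    reachAt-zero (step _ _ _) = refl

    reachAt-length : ∀ {u v} (r : Reach G X u v) → reachAt r (reachLength r) ≡ v
    reachAt-length (here _)     = refl
    reachAt-length (step _ _ r) = reachAt-length r

    reachAt-∈ : ∀ {u v} (r : Reach G X u v) t → t ≤ reachLength r → reachAt r t ∈ X
    reachAt-∈ (here u∈X)     _       _         = u∈X
    reachAt-∈ (step u∈X _ _) zero    _         = u∈X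
    reachAt-∈ (step _ _ r)   (suc t) (s≤s t≤) = reachAt-∈ r t t≤

    reachAt-link : ∀ {u v} (r : Reach G X u v) t → t < reachLength r →
                   Adj G (reachAt r t) (reachAt r (suc t))
    reachAt-link (step _ a r) zero    _         = subst (Adj G _) (≡-sym (reachAt-zero r)) a
    reachAt-link (step _ _ r) (suc t) (s≤s t<) = reachAt-link r t t<

skip : ℕ → ℕ → ℕ → ℕ
skip i       g zero    = zero
skip zero    g (suc t) = suc t + g
skip (suc i) g (suc t) = suc (skip i g t)

skip-≤ : ∀ {i g t} → t ≤ i → skip i g t ≡ t
skip-≤ {t = zero}          _         = refl
skip-≤ {suc i} {t = suc t} (s≤s t≤i) = cong suc (skip-≤ t≤i)

skip-> : ∀ {i g t} → i < t → skip i g t ≡ t + g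
skip-> {zero}  {t = suc t} _         = refl
skip-> {suc i} {t = suc t} (s≤s i<t) = cong suc (skip-> i<t)

module Walks (G : Graph) (U A B : Subset (n G)) where

  record Walk : Set where
    field
      steps : ℕ
      at    : ℕ → V G
      at-U  : ∀ t → t ≤ steps → at t ∈ U
      link  : ∀ t → t < steps → Adj G (at t) (at (suc t))
      from-A : HasNbrIn G A (at 0)
      to-B   : HasNbrIn G B (at steps)
  open Walk public

  record Tight (w : Walk) : Set where
    field
      A-only-first : ∀ t → 0 < t → t ≤ steps w → ¬ HasNbrIn G A (at w t)
      B-only-last  : ∀ t → t < steps w → ¬ HasNbrIn G B (at w t)
      chordless    : ∀ i j → suc i < j → j ≤ steps w → ¬ Adj G (at w i) (at w j)
      distinct     : ∀ i j → i < j → j ≤ steps w → at w i ≢ at w j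

  Reach⇒Walk : ∀ {u v} → Reach G U u v → HasNbrIn G A u → HasNbrIn G B v → Walk
  Reach⇒Walk r u-A v-B = record
    { steps  = reachLength G r
    ; at     = reachAt G r
    ; at-U   = reachAt-∈ G r
    ; link   = reachAt-link G r
    ; from-A = subst (HasNbrIn G A) (≡-sym (reachAt-zero G r)) u-A
    ; to-B   = subst (HasNbrIn G B) (≡-sym (reachAt-length G r)) v-B
    }

  reindex : (w : Walk) (m : ℕ) (σ : ℕ → ℕ) →
            (∀ t → t ≤ m → σ t ≤ steps w) →
            (∀ t → t < m → Adj G (at w (σ t)) (at w (σ (suc t)))) →
            HasNbrIn G A (at w (σ 0)) → HasNbrIn G B (at w (σ m)) → Walk
  reindex w m σ σ≤ σ-link σ0-A σm-B = record
    { steps = m ; at = at w ∘ σ ; at-U = λ t t≤m → at-U w (σ t) (σ≤ t t≤m)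
    ; link = σ-link ; from-A = σ0-A ; to-B = σm-B }

  Shorter : Walk → Set
  Shorter w = Σ Walk λ w′ → steps w′ < steps w

  module _ (w : Walk) where

    late-A : ∀ d → 0 < d → d ≤ steps w → HasNbrIn G A (at w d) → Shorter w
    late-A d 0<d d≤ d-A = reindex w (steps w ∸ d) (d +_) bound link′ d+0-A end-B , ∸-monoʳ-< 0<d d≤
      where
      d+rest≡ : d + (steps w ∸ d) ≡ steps w
      d+rest≡ = m+[n∸m]≡n d≤
      bound : ∀ t → t ≤ steps w ∸ d → d + t ≤ steps w
      bound t t≤ = subst (d + t ≤_) d+rest≡ (+-monoʳ-≤ d t≤)
      link′ : ∀ t → t < steps w ∸ d → Adj G (at w (d + t)) (at w (d + suc t))
      link′ t t< = subst (λ s → Adj G (at w (d + t)) (at w s)) (≡-sym (+-suc d t))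
                     (link w (d + t) (subst (d + t <_) d+rest≡ (+-monoʳ-< d t<)))
      d+0-A : HasNbrIn G A (at w (d + 0))
      d+0-A = subst (λ s → HasNbrIn G A (at w s)) (≡-sym (+-identityʳ d)) d-A
      end-B : HasNbrIn G B (at w (d + (steps w ∸ d)))
      end-B = subst (λ s → HasNbrIn G B (at w s)) (≡-sym d+rest≡) (to-B w)

    early-B : ∀ t → t < steps w → HasNbrIn G B (at w t) → Shorter w
    early-B t t< t-B =
      reindex w t id (λ s s≤ → ≤-trans s≤ (<⇒≤ t<)) (λ s s< → link w s (<-trans s< t<)) (from-A w) t-B , t<

    bypass : ∀ i g → 0 < g → suc i + g ≤ steps w → Adj G (at w i) (at w (suc i + g)) → Shorter w
    bypass i g 0<g j≤ i~j = reindex w (steps w ∸ g) (skip i g) bound link′ (from-A w) end-B , ∸-monoʳ-< 0<g g≤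
      where
      g≤ : g ≤ steps w
      g≤ = ≤-trans (m≤n+m g (suc i)) j≤
      rest+g≡ : steps w ∸ g + g ≡ steps w
      rest+g≡ = m∸n+n≡m g≤
      i<rest : i < steps w ∸ g
      i<rest = m+n≤o⇒m≤o∸n (suc i) j≤
      bound : ∀ t → t ≤ steps w ∸ g → skip i g t ≤ steps w
      bound t t≤ with t ≤? i
      ... | yes t≤i rewrite skip-≤ {g = g} t≤i = ≤-trans t≤ (m∸n≤m (steps w) g)
      ... | no  t≰i rewrite skip-> {g = g} (≰⇒> t≰i) = subst (t + g ≤_) rest+g≡ (+-monoˡ-≤ g t≤)
      link′ : ∀ t → t < steps w ∸ g → Adj G (at w (skip i g t)) (at w (skip i g (suc t)))
      link′ t t< with <-cmp t i
      ... | tri< t<i _ _ rewrite skip-≤ {g = g} (<⇒≤ t<i) | skip-≤ {g = g} t<i =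
        link w t (<-≤-trans t< (m∸n≤m (steps w) g))
      ... | tri≈ _ refl _ rewrite skip-≤ {g = g} (≤-refl {t}) | skip-> {g = g} (n<1+n t) = i~j
      ... | tri> _ _ i<t rewrite skip-> {g = g} i<t | skip-> {g = g} (<-trans i<t (n<1+n t)) =
        link w (t + g) (subst (t + g <_) rest+g≡ (+-monoˡ-< g t<))
      end-B : HasNbrIn G B (at w (skip i g (steps w ∸ g)))
      end-B rewrite skip-> {g = g} i<rest | rest+g≡ = to-B w

    chord : ∀ i j → suc i < j → j ≤ steps w → Adj G (at w i) (at w j) → Shorter w
    chord i j 1+i<j j≤ i~j with m≤n⇒∃[o]m+o≡n 1+i<j
    ... | o , refl =
      bypass i (suc o) (s≤s z≤n) (subst (_≤ steps w) j≡ j≤) (subst (Adj G (at w i) ∘ at w) j≡ i~j)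
      where
      j≡ : suc (suc i) + o ≡ suc i + suc o
      j≡ = ≡-sym (+-suc (suc i) o)

    repeat : ∀ i j → i < j → j ≤ steps w → at w i ≡ at w j → Shorter w
    repeat i j i<j j≤ i≡j with m≤n⇒m<n∨m≡n j≤
    ... | inj₂ refl = early-B i i<j (subst (HasNbrIn G B) (≡-sym i≡j) (to-B w))
    ... | inj₁ j<   with m≤n⇒∃[o]m+o≡n i<j
    ...   | o , refl = bypass i (suc o) (s≤s z≤n) (subst (_≤ steps w) j≡ j<)
                         (subst₂ (λ x s → Adj G x (at w s)) (≡-sym i≡j) j≡ (link w (suc i + o) j<))
      where
      j≡ : suc (suc i + o) ≡ suc i + suc o
      j≡ = ≡-sym (+-suc (suc i) o)

  tight-or-shorter : (w : Walk) → Tight w ⊎ Shorter w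
  tight-or-shorter w
    with anyUpTo? (λ t → (0 <? t) ×-dec hasNbrIn? G A (at w t)) (suc (steps w))
  ... | yes (t , s≤s t≤ , 0<t , t-A) = inj₂ (late-A w t 0<t t≤ t-A)
  ... | no ¬late-A with anyUpTo? (λ t → hasNbrIn? G B (at w t)) (steps w)
  ... | yes (t , t< , t-B) = inj₂ (early-B w t t< t-B)
  ... | no ¬early-B
    with anyUpTo? (λ j → anyUpTo? (λ i → (suc i <? j) ×-dec dec G (at w i) (at w j)) j) (suc (steps w))
  ... | yes (j , s≤s j≤ , i , _ , 1+i<j , i~j) = inj₂ (chord w i j 1+i<j j≤ i~j)
  ... | no ¬chord with anyUpTo? (λ j → anyUpTo? (λ i → at w i ≟ᶠ at w j) j) (suc (steps w))
  ... | yes (j , s≤s j≤ , i , i<j , i≡j) = inj₂ (repeat w i j i<j j≤ i≡j)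
  ... | no ¬repeat = inj₁ record
    { A-only-first = λ t 0<t t≤ t-A → ¬late-A (t , s≤s t≤ , 0<t , t-A)
    ; B-only-last  = λ t t< t-B → ¬early-B (t , t< , t-B)
    ; chordless    = λ i j 1+i<j j≤ i~j → ¬chord (j , s≤s j≤ , i , <-trans (n<1+n i) 1+i<j , 1+i<j , i~j)
    ; distinct     = λ i j i<j j≤ i≡j → ¬repeat (j , s≤s j≤ , i , i<j , i≡j)
    }

  tighten : Walk → Σ Walk Tight
  tighten w = go w (<-wellFounded (steps w))
    where
    go : (w : Walk) → Acc _<_ (steps w) → Σ Walk Tight
    go w (acc shorter) with tight-or-shorter w
    ... | inj₁ tight = w , tight
    ... | inj₂ (w′ , w′<w) = go w′ (shorter w′<w)

module DegreeTwoInterior (H : Graph) (P : Path H) (K : ℕ) (len≡ : len P ≡ suc (suc K))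
                         (deg : ∀ i → Internal P i → degree H (vtx P i) ≡ 2) where

  k : ℕ
  k = suc (suc K)

  ≤K⇒≤k : ∀ {b} → b ≤ K → b ≤ k
  ≤K⇒≤k b≤K = ≤-trans b≤K (m≤n+m K 2)

  ≤K⇒<k : ∀ {b} → b ≤ K → b < k
  ≤K⇒<k b≤K = s≤s (≤-trans b≤K (n≤1+n K))

  k≢≤K : ∀ {b} → b ≤ K → k ≢ b
  k≢≤K b≤K k≡b = 1+n≰n (≤-trans (n≤1+n (suc K)) (subst (_≤ K) (≡-sym k≡b) b≤K))

  -- p a is the a-th vertex of P for a ≤ len P and the junk value start P beyond.
  p : ℕ → V H
  p a with a <? suc (len P)
  ... | yes a<len = vtx P (fromℕ< a<len)
  ... | no  _     = start P

  p-vtx : ∀ a (a<len : a < suc (len P)) → p a ≡ vtx P (fromℕ< a<len)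
  p-vtx a a<len with a <? suc (len P)
  ... | yes a<len′ = cong (vtx P) (Finₚ.fromℕ<-cong a a refl a<len′ a<len)
  ... | no  a≮len  = contradiction a<len a≮len

  p-toℕ : ∀ i → p (toℕ i) ≡ vtx P i
  p-toℕ i = trans (p-vtx (toℕ i) (Finₚ.toℕ<n i)) (cong (vtx P) (Finₚ.fromℕ<-toℕ i _))

  ≤k⇒<1+len : ∀ {a} → a ≤ k → a < suc (len P)
  ≤k⇒<1+len a≤k = s≤s (subst (_ ≤_) (≡-sym len≡) a≤k)

  p-injective : ∀ {a b} → a ≤ k → b ≤ k → p a ≡ p b → a ≡ b
  p-injective {a} {b} a≤k b≤k pa≡pb = begin
    a                      ≡⟨ Finₚ.toℕ-fromℕ< a< ⟨
    toℕ (fromℕ< a<)        ≡⟨ cong toℕ (inj P (trans (≡-sym (p-vtx a a<)) (trans pa≡pb (p-vtx b b<)))) ⟩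
    toℕ (fromℕ< b<)        ≡⟨ Finₚ.toℕ-fromℕ< b< ⟩
    b                      ∎
    where
    open ≡-Reasoning
    a< : a < suc (len P)
    a< = ≤k⇒<1+len a≤k
    b< : b < suc (len P)
    b< = ≤k⇒<1+len b≤k

  p-adjacent : ∀ {a} → a < k → Adj H (p a) (p (suc a))
  p-adjacent {a} a<k = subst₂ (Adj H) (≡-sym pa) (≡-sym psa) (adj P i)
    where
    i : Fin (len P)
    i = fromℕ< (subst (a <_) (≡-sym len≡) a<k)
    pa : p a ≡ vtx P (inject₁ i)
    pa = trans (cong p (≡-sym (trans (Finₚ.toℕ-inject₁ i) (Finₚ.toℕ-fromℕ< _)))) (p-toℕ (inject₁ i))
    psa : p (suc a) ≡ vtx P (fsuc i)
    psa = trans (cong (p ∘ suc) (≡-sym (Finₚ.toℕ-fromℕ< _))) (p-toℕ (fsuc i))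

  internal-degree : ∀ {b} → b ≤ K → degree H (p (suc b)) ≡ 2
  internal-degree {b} b≤K = subst (λ v → degree H v ≡ 2) (≡-sym (p-vtx (suc b) 1+b<)) (deg i internal)
    where
    1+b< : suc b < suc (len P)
    1+b< = ≤k⇒<1+len (≤K⇒<k b≤K)
    i : Fin (suc (len P))
    i = fromℕ< 1+b<
    internal : Internal P i
    internal rewrite Finₚ.toℕ-fromℕ< 1+b< = s≤s z≤n , subst (suc b <_) (≡-sym len≡) (s≤s (s≤s b≤K))

  internal-neighbour : ∀ {b v} → b ≤ K → Adj H (p (suc b)) v → v ≡ p b ⊎ v ≡ p (suc (suc b))
  internal-neighbour {b} {v} b≤K a with v ≟ᶠ p b | v ≟ᶠ p (suc (suc b))
  ... | yes v≡ | _      = inj₁ v≡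
  ... | no _   | yes v≡ = inj₂ v≡
  ... | no v≢  | no v≢′ = contradiction (subst (3 ≤_) (internal-degree b≤K) three-neighbours) (<-irrefl refl)
    where
    three-neighbours : 3 ≤ degree H (p (suc b))
    three-neighbours = x,y,z∈p⇒3≤∣p∣ (Adj⇒∈N H (sym H (p-adjacent (≤K⇒<k b≤K))))
      (Adj⇒∈N H (p-adjacent (s≤s (s≤s b≤K)))) (Adj⇒∈N H a)
      (λ e → m≢1+n+m b (≡-sym (p-injective (s≤s (s≤s b≤K)) (≤K⇒≤k b≤K) e)))
      v≢ v≢′

  internal≢first : ∀ {b} → b ≤ K → p (suc b) ≢ p 0
  internal≢first b≤K e with p-injective (≤K⇒<k b≤K) z≤n e
  ... | ()

  internal≢last : ∀ {b} → b ≤ K → p (suc b) ≢ p k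
  internal≢last b≤K e = 1+n≰n (subst (_≤ K) (suc-injective (p-injective (≤K⇒<k b≤K) ≤-refl e)) b≤K)

  internal-neighbour-index : ∀ {b c} → b ≤ K → c ≤ k → Adj H (p (suc b)) (p c) → c ≡ b ⊎ c ≡ suc (suc b)
  internal-neighbour-index b≤K c≤k a with internal-neighbour b≤K a
  ... | inj₁ pc≡ = inj₁ (p-injective c≤k (≤K⇒≤k b≤K) pc≡)
  ... | inj₂ pc≡ = inj₂ (p-injective c≤k (s≤s (s≤s b≤K)) pc≡)

  p≢outside : ∀ {a v} → ¬ OnPath P v → a ≤ k → p a ≢ v
  p≢outside {a} ¬on a≤k pa≡v = ¬on (fromℕ< a< , trans (≡-sym (p-vtx a a<)) pa≡v)
    where
    a< : a < suc (len P)
    a< = ≤k⇒<1+len a≤k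

  internal-not-adjacent-outside : ∀ {b v} → ¬ OnPath P v → b ≤ K → ¬ Adj H (p (suc b)) v
  internal-not-adjacent-outside ¬on b≤K a with internal-neighbour b≤K a
  ... | inj₁ v≡pb   = p≢outside ¬on (≤K⇒≤k b≤K) (≡-sym v≡pb)
  ... | inj₂ v≡p2+b = p≢outside ¬on (s≤s (s≤s b≤K)) (≡-sym v≡p2+b)

  position : ∀ {a i} → p a ≡ vtx P i → a ≤ k → a ≡ toℕ i
  position {i = i} pa≡ a≤k =
    p-injective a≤k (subst (toℕ i ≤_) len≡ (Finₚ.toℕ≤pred[n] i)) (trans pa≡ (≡-sym (p-toℕ i)))

  data Kind (v : V H) : Set where
    outside  : ¬ OnPath P v → Kind v
    first    : p 0 ≡ v → Kind v
    internal : ∀ b → b ≤ K → p (suc b) ≡ v → Kind v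
    last     : p k ≡ v → Kind v

  kind : ∀ v → Kind v
  kind v with Finₚ.any? (λ i → vtx P i ≟ᶠ v)
  ... | no ¬on        = outside ¬on
  ... | yes (i , i↦v) = classify (toℕ i) (subst (toℕ i ≤_) len≡ (Finₚ.toℕ≤pred[n] i)) (trans (p-toℕ i) i↦v)
    where
    classify : ∀ a → a ≤ k → p a ≡ v → Kind v
    classify zero    _     pa≡v = first pa≡v
    classify (suc b) 1+b≤k pa≡v with b ≤? K
    ... | yes b≤K = internal b b≤K pa≡v
    ... | no  b≰K = last (subst (λ c → p (suc c) ≡ v) (≤-antisym (≤-pred 1+b≤k) (≰⇒> b≰K)) pa≡v)

module Reduction (H G : Graph) (P : Path H) (K : ℕ) (len≡ : len P ≡ suc (suc K))
                 (deg : ∀ i → Internal P i → degree H (vtx P i) ≡ 2) (X : InducedMinorModel H G) where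

  open DegreeTwoInterior H P K len≡ deg

  A B U : Subset (n G)
  A = bag X (p 0)
  B = bag X (p k)
  U = ⋃ (applyUpTo (λ b → bag X (p (suc b))) (suc K))

  ∈U⁺ : ∀ {b x} → b ≤ K → x ∈ bag X (p (suc b)) → x ∈ U
  ∈U⁺ b≤K = ∈⋃-applyUpTo⁺ (λ b → bag X (p (suc b))) (s≤s b≤K)

  ∈U⁻ : ∀ {x} → x ∈ U → ∃ λ b → b ≤ K × x ∈ bag X (p (suc b))
  ∈U⁻ x∈U with ∈⋃-applyUpTo⁻ (λ b → bag X (p (suc b))) (suc K) x∈U
  ... | b , s≤s b≤K , x∈ = b , b≤K , x∈

  open Walks G U A B public

  Touch⇒Adj : ∀ {v v′ x y} → v ≢ v′ → x ∈ bag X v → y ∈ bag X v′ → Adj G x y → Adj H v v′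
  Touch⇒Adj v≢v′ x∈ y∈ x~y = Equivalence.to (touch X v≢v′) (_ , _ , x∈ , y∈ , x~y)

  consecutive-touch : ∀ {a} → a < k → Touch G (bag X (p a)) (bag X (p (suc a)))
  consecutive-touch {a} a<k = Equivalence.from (touch X pa≢psa) (p-adjacent a<k)
    where
    pa≢psa : p a ≢ p (suc a)
    pa≢psa e = 1+n≢n (≡-sym (p-injective (<⇒≤ a<k) a<k e))

  reach-internal : ∀ {u} → u ∈ bag X (p 1) → ∀ b → b ≤ K → ∃ λ v → v ∈ bag X (p (suc b)) × Reach G U u v
  reach-internal u∈ zero    _     = _ , u∈ , here (∈U⁺ z≤n u∈)
  reach-internal u∈ (suc b) 1+b≤K with reach-internal u∈ b (≤-trans (n≤1+n b) 1+b≤K)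
                                     | consecutive-touch {suc b} (≤K⇒<k 1+b≤K)
  ... | v , v∈ , u⇝v | x , y , x∈ , y∈ , x~y =
    y , y∈ , Reach-trans G u⇝v (Reach-trans G v⇝x (step (∈U⁺ b≤K x∈) x~y (here (∈U⁺ 1+b≤K y∈))))
    where
    b≤K : b ≤ K
    b≤K = ≤-trans (n≤1+n b) 1+b≤K
    v⇝x : Reach G U v x
    v⇝x = Reach-mono G (∈U⁺ b≤K) (proj₂ (connected X (p (suc b))) v∈ x∈)

  initial-walk : Walk
  initial-walk with consecutive-touch {0} (s≤s z≤n)
  ... | a , u , a∈A , u∈ , a~u with reach-internal u∈ K ≤-refl | consecutive-touch {suc K} ≤-refl
  ...   | v , v∈ , u⇝v | x , y , x∈ , y∈B , x~y =
    Reach⇒Walk (Reach-trans G u⇝v (Reach-mono G (∈U⁺ ≤-refl) (proj₂ (connected X (p (suc K))) v∈ x∈)))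
               (a , a∈A , sym G a~u) (y , y∈B , x~y)

  bag-neighbour : ∀ {b c x y} → b ≤ K → c ≤ k → x ∈ bag X (p (suc b)) → y ∈ bag X (p c) →
                  Adj G x y → c ≢ suc b → c ≡ b ⊎ c ≡ suc (suc b)
  bag-neighbour b≤K c≤k x∈ y∈ x~y c≢1+b =
    internal-neighbour-index b≤K c≤k (Touch⇒Adj (λ e → c≢1+b (≡-sym (p-injective (≤K⇒<k b≤K) c≤k e))) x∈ y∈ x~y)

  U-isolated-from-outside : ∀ {v x y} → ¬ OnPath P v → x ∈ U → y ∈ bag X v → ¬ Adj G x y
  U-isolated-from-outside ¬on x∈U y∈ x~y with ∈U⁻ x∈U
  ... | b , b≤K , x∈ = internal-not-adjacent-outside ¬on b≤K (Touch⇒Adj (p≢outside ¬on (≤K⇒<k b≤K)) x∈ y∈ x~y)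

  ∉U : ∀ {v x} → (∀ {b} → b ≤ K → p (suc b) ≢ v) → x ∈ bag X v → ¬ x ∈ U
  ∉U not-internal x∈ x∈U with ∈U⁻ x∈U
  ... | b , b≤K , x∈′ = disjoint X (not-internal b≤K ∘ ≡-sym) x∈ x∈′

  level-step : ∀ {b b′ x y} → b ≤ K → b′ ≤ K → x ∈ bag X (p (suc b)) → y ∈ bag X (p (suc b′)) →
               Adj G x y → b′ ≤ suc b
  level-step {b} {b′} b≤K b′≤K x∈ y∈ x~y with b′ ≟ b
  ... | yes refl = n≤1+n b
  ... | no b′≢b with bag-neighbour b≤K (≤K⇒<k b′≤K) x∈ y∈ x~y (b′≢b ∘ suc-injective)
  ...   | inj₁ 1+b′≡b = ≤-trans (n≤1+n b′) (≤-trans (≤-reflexive 1+b′≡b) (n≤1+n b))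
  ...   | inj₂ 1+b′≡2+b = ≤-reflexive (suc-injective 1+b′≡2+b)

  level-≤ : (Q : Walk) → ∀ t → t ≤ steps Q → ∀ {b} → b ≤ K → at Q t ∈ bag X (p (suc b)) → b ≤ t
  level-≤ Q zero _ b≤K q∈ with from-A Q
  ... | y , y∈A , q~y with bag-neighbour b≤K z≤n q∈ y∈A q~y (λ ())
  ...   | inj₁ refl = z≤n
  level-≤ Q (suc t) t< b≤K q∈ with ∈U⁻ (at-U Q t (<⇒≤ t<))
  ... | b′ , b′≤K , q′∈ =
    ≤-trans (level-step b′≤K b≤K q′∈ q∈ (link Q t t<)) (s≤s (level-≤ Q t (<⇒≤ t<) b′≤K q′∈))

  K≤steps : (Q : Walk) → K ≤ steps Q
  K≤steps Q with ∈U⁻ (at-U Q (steps Q) ≤-refl) | to-B Q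
  ... | b , b≤K , q∈ | y , y∈B , q~y
    with bag-neighbour b≤K ≤-refl q∈ y∈B q~y (internal≢last b≤K ∘ cong p ∘ ≡-sym)
  ...   | inj₁ k≡b = contradiction k≡b (k≢≤K b≤K)
  ...   | inj₂ refl = level-≤ Q (steps Q) ≤-refl b≤K q∈

  module Tightened (Q : Walk) (tight : Tight Q) where
    open Tight tight

    q : ℕ → V G
    q = at Q

    ℓ : ℕ
    ℓ = steps Q

    -- q (r + b) becomes the bag of p (1 + b) for b ≤ K; q 0, …, q (r - 1) join the bag of p 0.
    r : ℕ
    r = ℓ ∸ K

    r+K≡ℓ : r + K ≡ ℓ
    r+K≡ℓ = m∸n+n≡m (K≤steps Q)

    r+b≤ℓ : ∀ {b} → b ≤ K → r + b ≤ ℓ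
    r+b≤ℓ {b} b≤K = subst (r + b ≤_) r+K≡ℓ (+-monoʳ-≤ r b≤K)

    <r⇒<ℓ : ∀ {j} → j < r → j < ℓ
    <r⇒<ℓ j<r = <-≤-trans j<r (m∸n≤m ℓ K)

    q-injective : ∀ {i j} → i ≤ ℓ → j ≤ ℓ → q i ≡ q j → i ≡ j
    q-injective {i} {j} i≤ j≤ qi≡qj with <-cmp i j
    ... | tri< i<j _ _ = contradiction qi≡qj (distinct i j i<j j≤)
    ... | tri≈ _ i≡j _ = i≡j
    ... | tri> _ _ j<i = contradiction (≡-sym qi≡qj) (distinct j i j<i i≤)

    adjacent-positions : ∀ {i j} → i ≤ ℓ → j ≤ ℓ → Adj G (q i) (q j) → j ≡ suc i ⊎ i ≡ suc j
    adjacent-positions {i} {j} i≤ j≤ qi~qj with <-cmp i j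
    ... | tri≈ _ refl _ = contradiction qi~qj (irrefl G)
    ... | tri< i<j _ _ with m≤n⇒m<n∨m≡n i<j
    ...   | inj₁ 1+i<j = contradiction qi~qj (chordless i j 1+i<j j≤)
    ...   | inj₂ 1+i≡j = inj₁ (≡-sym 1+i≡j)
    adjacent-positions i≤ j≤ qi~qj | tri> _ _ j<i with m≤n⇒m<n∨m≡n j<i
    ...   | inj₁ 1+j<i = contradiction (sym G qi~qj) (chordless _ _ 1+j<i i≤)
    ...   | inj₂ 1+j≡i = inj₂ (≡-sym 1+j≡i)

    S : Subset (n G)
    S = ⋃ (applyUpTo (⁅_⁆ ∘ q) r)

    ∈S⁺ : ∀ {j} → j < r → q j ∈ S
    ∈S⁺ j<r = ∈⋃-applyUpTo⁺ (⁅_⁆ ∘ q) j<r (x∈⁅x⁆ _)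

    ∈S⁻ : ∀ {x} → x ∈ S → ∃ λ j → j < r × q j ≡ x
    ∈S⁻ x∈S with ∈⋃-applyUpTo⁻ (⁅_⁆ ∘ q) r x∈S
    ... | j , j<r , x∈⁅qj⁆ = j , j<r , ≡-sym (x∈⁅y⁆⇒x≡y _ x∈⁅qj⁆)

    newBag : ∀ {v} → Kind v → Subset (n G)
    newBag {v} (outside _)      = bag X v
    newBag     (first _)        = A ∪ S
    newBag     (internal b _ _) = ⁅ q (r + b) ⁆
    newBag {v} (last _)         = bag X v

    bag′ : V H → Subset (n G)
    bag′ v = newBag (kind v)

    A∪S-connected : Connected G (A ∪ S)
    A∪S-connected = (a₀ , x∈p∪q⁺ (inj₁ a₀∈A)) , λ x∈ y∈ → Reach-trans G (⇝a₀ x∈) (Reach-sym G (⇝a₀ y∈))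
      where
      a₀ : V G
      a₀ = proj₁ (proj₁ (connected X (p 0)))
      a₀∈A : a₀ ∈ A
      a₀∈A = proj₂ (proj₁ (connected X (p 0)))
      A⇝a₀ : ∀ {x} → x ∈ A → Reach G (A ∪ S) x a₀
      A⇝a₀ x∈A = Reach-mono G (x∈p∪q⁺ ∘ inj₁) (proj₂ (connected X (p 0)) x∈A a₀∈A)
      S⇝a₀ : ∀ j → j < r → Reach G (A ∪ S) (q j) a₀
      S⇝a₀ zero    0<r   = let y , y∈A , q~y = from-A Q in step (x∈p∪q⁺ (inj₂ (∈S⁺ 0<r))) q~y (A⇝a₀ y∈A)
      S⇝a₀ (suc j) 1+j<r = step (x∈p∪q⁺ (inj₂ (∈S⁺ 1+j<r))) (sym G (link Q j (<r⇒<ℓ j<r))) (S⇝a₀ j j<r)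
        where
        j<r : j < r
        j<r = <-trans (n<1+n j) 1+j<r
      ⇝a₀ : ∀ {x} → x ∈ A ∪ S → Reach G (A ∪ S) x a₀
      ⇝a₀ x∈ with x∈p∪q⁻ A S x∈
      ... | inj₁ x∈A = A⇝a₀ x∈A
      ... | inj₂ x∈S with ∈S⁻ x∈S
      ...   | j , j<r , refl = S⇝a₀ j j<r

    connected′ : ∀ v → Connected G (bag′ v)
    connected′ v with kind v
    ... | outside _      = connected X v
    ... | first _        = A∪S-connected
    ... | internal b _ _ = ⁅⁆-connected G (q (r + b))
    ... | last _         = connected X v

    owner : ℕ → V H
    owner j with j <? r
    ... | yes _ = p 0
    ... | no  _ = p (suc (j ∸ r))

    owner-< : ∀ {j} → j < r → owner j ≡ p 0
    owner-< {j} j<r with j <? r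
    ... | yes _   = refl
    ... | no  j≮r = contradiction j<r j≮r

    owner-+ : ∀ b → owner (r + b) ≡ p (suc b)
    owner-+ b with r + b <? r
    ... | yes r+b<r = contradiction r+b<r (m+n≮m r b)
    ... | no  _     = cong (p ∘ suc) (m+n∸m≡n r b)

    data Source (v : V H) (x : V G) : Set where
      original : x ∈ bag X v → ¬ x ∈ U → Source v x
      walk     : ∀ j → j ≤ ℓ → q j ≡ x → owner j ≡ v → Source v x

    source : ∀ v {x} → x ∈ bag′ v → Source v x
    source v x∈ with kind v
    ... | outside ¬on = original x∈ (∉U (λ b≤K → p≢outside ¬on (≤K⇒<k b≤K)) x∈)
    ... | first refl with x∈p∪q⁻ A S x∈
    ...   | inj₁ x∈A = original x∈A (∉U internal≢first x∈A)
    ...   | inj₂ x∈S with ∈S⁻ x∈S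
    ...     | j , j<r , refl = walk j (<⇒≤ (<r⇒<ℓ j<r)) refl (owner-< j<r)
    source v x∈ | internal b b≤K refl = walk (r + b) (r+b≤ℓ b≤K) (≡-sym (x∈⁅y⁆⇒x≡y _ x∈)) (owner-+ b)
    source v x∈ | last refl = original x∈ (∉U internal≢last x∈)

    disjoint′ : ∀ {v v′} → v ≢ v′ → ∀ {x} → x ∈ bag′ v → x ∈ bag′ v′ → ⊥
    disjoint′ {v} {v′} v≢v′ x∈ x∈′ with source v x∈ | source v′ x∈′
    ... | original x∈v _      | original x∈v′ _     = disjoint X v≢v′ x∈v x∈v′
    ... | original _ x∉U      | walk j j≤ refl _    = x∉U (at-U Q j j≤)
    ... | walk j j≤ refl _    | original _ x∉U      = x∉U (at-U Q j j≤)
    ... | walk j j≤ qj≡x oj≡v | walk j′ j′≤ qj′≡x oj′≡v′ =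
      v≢v′ (trans (≡-sym oj≡v) (trans (cong owner (q-injective j≤ j′≤ (trans qj≡x (≡-sym qj′≡x)))) oj′≡v′))

    included′ : ∀ v {x} → x ∈ bag′ v → Σ (V H) λ v′ → x ∈ bag X v′
    included′ v x∈ with source v x∈
    ... | original x∈v _ = v , x∈v
    ... | walk j j≤ refl _ with ∈U⁻ (at-U Q j j≤)
    ...   | b , _ , x∈b = p (suc b) , x∈b

    link-+ : ∀ {b} → suc b ≤ K → Adj G (q (r + b)) (q (r + suc b))
    link-+ {b} 1+b≤K = subst (Adj G (q (r + b)) ∘ q) (≡-sym (+-suc r b))
                         (link Q (r + b) (subst (_≤ ℓ) (+-suc r b) (r+b≤ℓ 1+b≤K)))

    q[r]-near-A∪S : HasNbrIn G (A ∪ S) (q r)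
    q[r]-near-A∪S = go r refl
      where
      go : ∀ s → s ≡ r → HasNbrIn G (A ∪ S) (q s)
      go zero    _     = let y , y∈A , q~y = from-A Q in y , x∈p∪q⁺ (inj₁ y∈A) , q~y
      go (suc s) 1+s≡r = q s , x∈p∪q⁺ (inj₂ (∈S⁺ s<r)) , sym G (link Q s (<r⇒<ℓ s<r))
        where
        s<r : s < r
        s<r = ≤-reflexive 1+s≡r

    outside-first : ∀ {v} → ¬ OnPath P v → Touch G (bag X v) (A ∪ S) ⇔ Adj H v (p 0)
    outside-first {v} ¬on = mk⇔ to from
      where
      v≢p0 : v ≢ p 0
      v≢p0 = p≢outside ¬on z≤n ∘ ≡-sym
      to : Touch G (bag X v) (A ∪ S) → Adj H v (p 0)
      to (x , y , x∈ , y∈ , x~y) with x∈p∪q⁻ A S y∈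
      ... | inj₁ y∈A = Touch⇒Adj v≢p0 x∈ y∈A x~y
      ... | inj₂ y∈S with ∈S⁻ y∈S
      ...   | j , j<r , refl =
        contradiction (sym G x~y) (U-isolated-from-outside ¬on (at-U Q j (<⇒≤ (<r⇒<ℓ j<r))) x∈)
      from : Adj H v (p 0) → Touch G (bag X v) (A ∪ S)
      from v~p0 with Equivalence.from (touch X v≢p0) v~p0
      ... | x , y , x∈ , y∈A , x~y = x , y , x∈ , x∈p∪q⁺ (inj₁ y∈A) , x~y

    outside-internal : ∀ {v b} → ¬ OnPath P v → b ≤ K → Touch G (bag X v) ⁅ q (r + b) ⁆ ⇔ Adj H v (p (suc b))
    outside-internal ¬on b≤K = ⇔-trans (Touch-⁅⁆⇔ G) (mk⇔
      (λ (y , y∈ , q~y) → contradiction q~y (U-isolated-from-outside ¬on (at-U Q _ (r+b≤ℓ b≤K)) y∈))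
      (λ v~p → contradiction (sym H v~p) (internal-not-adjacent-outside ¬on b≤K)))

    first-internal : ∀ {b} → b ≤ K → Touch G (A ∪ S) ⁅ q (r + b) ⁆ ⇔ Adj H (p 0) (p (suc b))
    first-internal {b} b≤K = ⇔-trans (Touch-⁅⁆⇔ G) (mk⇔ to from)
      where
      b≡0 : HasNbrIn G (A ∪ S) (q (r + b)) → b ≡ 0
      b≡0 (y , y∈ , q~y) with x∈p∪q⁻ A S y∈
      ... | inj₁ y∈A with m≤n⇒m<n∨m≡n (z≤n {r + b})
      ...   | inj₁ 0<r+b = contradiction (y , y∈A , q~y) (A-only-first (r + b) 0<r+b (r+b≤ℓ b≤K))
      ...   | inj₂ 0≡r+b = m+n≤m⇒n≡0 r (subst (_≤ r) 0≡r+b z≤n)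
      b≡0 (y , y∈ , q~y) | inj₂ y∈S with ∈S⁻ y∈S
      ... | j , j<r , refl with adjacent-positions (r+b≤ℓ b≤K) (<⇒≤ (<r⇒<ℓ j<r)) q~y
      ...   | inj₁ refl    = contradiction (<-trans (n<1+n _) j<r) (m+n≮m r b)
      ...   | inj₂ r+b≡1+j = m+n≤m⇒n≡0 r (≤-trans (≤-reflexive r+b≡1+j) j<r)
      to : HasNbrIn G (A ∪ S) (q (r + b)) → Adj H (p 0) (p (suc b))
      to near = subst (λ c → Adj H (p 0) (p (suc c))) (≡-sym (b≡0 near)) (p-adjacent (s≤s z≤n))
      from : Adj H (p 0) (p (suc b)) → HasNbrIn G (A ∪ S) (q (r + b))
      from p0~p1+b with internal-neighbour-index b≤K z≤n (sym H p0~p1+b)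
      ... | inj₁ refl = subst (HasNbrIn G (A ∪ S) ∘ q) (≡-sym (+-identityʳ r)) q[r]-near-A∪S

    first-last : Touch G (A ∪ S) B ⇔ Adj H (p 0) (p k)
    first-last = mk⇔ to from
      where
      p0≢pk : p 0 ≢ p k
      p0≢pk e with p-injective z≤n ≤-refl e
      ... | ()
      to : Touch G (A ∪ S) B → Adj H (p 0) (p k)
      to (x , y , x∈ , y∈B , x~y) with x∈p∪q⁻ A S x∈
      ... | inj₁ x∈A = Touch⇒Adj p0≢pk x∈A y∈B x~y
      ... | inj₂ x∈S with ∈S⁻ x∈S
      ...   | j , j<r , refl = contradiction (y , y∈B , x~y) (B-only-last j (<r⇒<ℓ j<r))
      from : Adj H (p 0) (p k) → Touch G (A ∪ S) B
      from p0~pk with Equivalence.from (touch X p0≢pk) p0~pk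
      ... | x , y , x∈A , y∈B , x~y = x , y , x∈p∪q⁺ (inj₁ x∈A) , y∈B , x~y

    r+-suc-injective : ∀ {c d} → r + c ≡ suc (r + d) → c ≡ suc d
    r+-suc-injective {c} {d} e = +-cancelˡ-≡ r c (suc d) (trans e (≡-sym (+-suc r d)))

    internal-internal : ∀ {b b′} → b ≤ K → b′ ≤ K →
                        Touch G ⁅ q (r + b) ⁆ ⁅ q (r + b′) ⁆ ⇔ Adj H (p (suc b)) (p (suc b′))
    internal-internal {b} {b′} b≤K b′≤K = ⇔-trans (⁅⁆-Touch-⁅⁆⇔ G) (mk⇔ to from)
      where
      to : Adj G (q (r + b)) (q (r + b′)) → Adj H (p (suc b)) (p (suc b′))
      to q~q′ with adjacent-positions (r+b≤ℓ b≤K) (r+b≤ℓ b′≤K) q~q′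
      ... | inj₁ e rewrite r+-suc-injective e = p-adjacent (s≤s (s≤s b≤K))
      ... | inj₂ e rewrite r+-suc-injective e = sym H (p-adjacent (s≤s (s≤s b′≤K)))
      from : Adj H (p (suc b)) (p (suc b′)) → Adj G (q (r + b)) (q (r + b′))
      from p~p′ with internal-neighbour-index b≤K (≤K⇒<k b′≤K) p~p′
      ... | inj₁ refl = sym G (link-+ b≤K)
      ... | inj₂ refl = link-+ b′≤K

    internal-last : ∀ {b} → b ≤ K → Touch G ⁅ q (r + b) ⁆ B ⇔ Adj H (p (suc b)) (p k)
    internal-last {b} b≤K = ⇔-trans (⁅⁆-Touch⇔ G) (mk⇔ to from)
      where
      to : HasNbrIn G B (q (r + b)) → Adj H (p (suc b)) (p k)
      to near with m≤n⇒m<n∨m≡n (r+b≤ℓ b≤K)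
      ... | inj₁ r+b<ℓ = contradiction near (B-only-last (r + b) r+b<ℓ)
      ... | inj₂ r+b≡ℓ rewrite +-cancelˡ-≡ r b K (trans r+b≡ℓ (≡-sym r+K≡ℓ)) = p-adjacent ≤-refl
      from : Adj H (p (suc b)) (p k) → HasNbrIn G B (q (r + b))
      from p~pk with internal-neighbour-index b≤K ≤-refl p~pk
      ... | inj₁ k≡b = contradiction k≡b (k≢≤K b≤K)
      ... | inj₂ k≡2+b = subst (HasNbrIn G B ∘ q) (≡-sym r+b≡ℓ) (to-B Q)
        where
        r+b≡ℓ : r + b ≡ ℓ
        r+b≡ℓ = trans (cong (r +_) (≡-sym (suc-injective (suc-injective k≡2+b)))) r+K≡ℓ

    touch′ : ∀ {v v′} → v ≢ v′ → Touch G (bag′ v) (bag′ v′) ⇔ Adj H v v′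
    touch′ {v} {v′} v≢v′ with kind v | kind v′
    ... | outside _             | outside _                  = touch X v≢v′
    ... | outside ¬on           | first refl                 = outside-first ¬on
    ... | outside ¬on           | internal b b≤K refl        = outside-internal ¬on b≤K
    ... | outside _             | last _                     = touch X v≢v′
    ... | first refl            | outside ¬on                = Touch⇔Adj-sym G H (outside-first ¬on)
    ... | first refl            | first refl                 = contradiction refl v≢v′
    ... | first refl            | internal b b≤K refl        = first-internal b≤K
    ... | first refl            | last refl                  = first-last
    ... | internal b b≤K refl   | outside ¬on                = Touch⇔Adj-sym G H (outside-internal ¬on b≤K)
    ... | internal b b≤K refl   | first refl                 = Touch⇔Adj-sym G H (first-internal b≤K)
    ... | internal b b≤K refl   | internal b′ b′≤K refl      = internal-internal b≤K b′≤K
    ... | internal b b≤K refl   | last refl                  = internal-last b≤K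
    ... | last _                | outside _                  = touch X v≢v′
    ... | last refl             | first refl                 = Touch⇔Adj-sym G H first-last
    ... | last refl             | internal b b≤K refl        = Touch⇔Adj-sym G H (internal-last b≤K)
    ... | last refl             | last refl                  = contradiction refl v≢v′

    model′ : InducedMinorModel H G
    model′ = record { bag = bag′ ; connected = connected′ ; disjoint = disjoint′ ; touch = touch′ }

    internal-trivial : ∀ i → Internal P i → Trivial {G} (bag′ (vtx P i))
    internal-trivial i (0<i , i<len) with kind (vtx P i)
    ... | outside ¬on        = contradiction (i , refl) ¬on
    ... | first p0≡          = contradiction (position p0≡ z≤n) (<⇒≢ 0<i)
    ... | internal b _ _     = ∣⁅x⁆∣≡1 (q (r + b))
    ... | last pk≡           = ⊥-elim (<-irrefl (≡-sym (position pk≡ ≤-refl)) (subst (toℕ i <_) len≡ i<len))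

    not-larger : ∀ v → v ≢ start P → ∣ bag′ v ∣ ≤ ∣ bag X v ∣
    not-larger v v≢start with kind v
    ... | outside _           = ≤-refl
    ... | first p0≡v          = contradiction (trans (≡-sym p0≡v) (p-toℕ _)) v≢start
    ... | internal b _ _      = subst (_≤ ∣ bag X v ∣) (≡-sym (∣⁅x⁆∣≡1 (q (r + b))))
                                  (≤-<-trans z≤n (x∈p⇒∣p-x∣<∣p∣ (proj₂ (proj₁ (connected X v)))))
    ... | last _              = ≤-refl

    outside-unchanged : ∀ v → ¬ OnPath P v → bag′ v ≡ bag X v
    outside-unchanged v ¬on with kind v
    ... | outside _        = refl
    ... | first p0≡v       = contradiction p0≡v (p≢outside ¬on z≤n)
    ... | internal _ b≤K e = contradiction e (p≢outside ¬on (≤K⇒<k b≤K))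
    ... | last pk≡v        = contradiction pk≡v (p≢outside ¬on ≤-refl)

PathTrivialisation : (H G : Graph) → Path H → InducedMinorModel H G → Set
PathTrivialisation H G P X = Σ (InducedMinorModel H G) λ X' →
    Included X' X
    × (∀ i → Internal P i → Trivial {G} (bag X' (vtx P i)))
    × Σ (V H) (λ e → (e ≡ start P ⊎ e ≡ end P)
    × (∀ w → w ≢ e → ∣ bag X' w ∣ ≤ ∣ bag X w ∣))
    × (∀ w → ¬ OnPath P w → bag X' w ≡ bag X w)

short-path : ∀ {H} G (P : Path H) (X : InducedMinorModel H G) → len P ≤ 1 → PathTrivialisation H G P X
short-path G P X len≤1 =
  X , (λ v x∈ → v , x∈) , no-internal , (start P , inj₁ refl , λ _ _ → ≤-refl) , λ _ _ → refl
  where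
  no-internal : ∀ i → Internal P i → Trivial {G} (bag X (vtx P i))
  no-internal i (0<i , i<len) = contradiction (≤-pred (≤-trans i<len len≤1)) (<⇒≱ 0<i)

lemma3p3 : (H G : Graph) (P : Path H)
    → (∀ i → Internal P i → degree H (vtx P i) ≡ 2)
    → (X : InducedMinorModel H G)
    → Σ (InducedMinorModel H G) λ X' →
    Included X' X
    × (∀ i → Internal P i → Trivial {G} (bag X' (vtx P i)))
    × Σ (V H) (λ e → (e ≡ start P ⊎ e ≡ end P)
    × (∀ w → w ≢ e → ∣ bag X' w ∣ ≤ ∣ bag X w ∣))
    × (∀ w → ¬ OnPath P w → bag X' w ≡ bag X w)
lemma3p3 H G P deg X with len P ≤? 1
... | yes len≤1 = short-path G P X len≤1
... | no  len≰1 with m≤n⇒∃[o]m+o≡n (≰⇒> len≰1)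
...   | K , 2+K≡len =
  model′ , included′ , internal-trivial , (start P , inj₁ refl , not-larger) , outside-unchanged
  where
  open Reduction H G P K (≡-sym 2+K≡len) deg X
  open Tightened (proj₁ (tighten initial-walk)) (proj₂ (tighten initial-walk))
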